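{- Let $X$ be a (short, normal-play) combinatorial game. Then $X$ is a conflict placement game if and only if there exists a Digraph placement game $G$ with the same literal form as $X$ (i.e. $G \cong X$).
   Context: All games are short normal-play two-player combinatorial games between Left and Right: no chance or hidden information, every play ends after a bounded number of moves, each position has finitely many options, and a player who cannot move on their turn loses. A game is written $X=\{Y_1,\dots,Y_k \mid Z_1,\dots,Z_t\}$ where the $Y_i$ are its Left options and the $Z_j$ its Right options. Two games have the same literal form, $X\cong X'$, if (recursively) their Left options and Right options correspond with identical literal forms; $0\cong\{\mid\}$. Digraph placement: given a finite digraph $G=(V,E)$ with a (not necessarily proper) colouring $\phi:V\to\{\text{blue},\text{red}\}$, the game played on $G$ is: on her turn Left chooses a remaining blue vertex $v$ and deletes the closed out-neighbourhood $N^+[v]$ (i.e. $v$ and all its out-neighbours); on his turn Right chooses a remaining red vertex $u$ and deletes $N^+[u]$. A player who cannot move loses. Placement game: a game that starts with an empty board, a move places pieces on part of the board subject to the rules, any piece legally placeable at a position was also legally placeable there at any earlier time, and placed pieces are never moved or removed. The moves of a placement game $X$ are recorded as triples $(x,T,p)$ ($T$ the piece type, $x$ its location, $p\in\{\text{Left},\text{Right}\}$ the player who may make it; if both players may place $T$ at $x$, two triples are recorded); $M(X)$ denotes this set of triples. A placement game $X$ is a conflict placement game if for every move $(x,T,p)\in M(X)$ there is a set $A_{x,T,p}\subseteq M(X)$ (its conflict set) such that $(x,T,p)$ is a legal move in a follower $Y$ of $X$ if and only if $Y$ is obtained from $X$ by a sequence of legal moves $(x_1,T_1,p_1),\dots,(x_n,T_n,p_n)$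 with $A_{x,T,p}\cap\{(x_1,T_1,p_1),\dots,(x_n,T_n,p_n)\}=\emptyset$. -}

module Defs where

open import Data.Nat using (ℕ; zero; suc)
open import Data.Bool using (Bool; true; false; _∧_; _∨_; not; if_then_else_)
open import Data.Fin using (Fin; _≟_)
open import Data.Fin.Subset using (Subset; _∉_)
open import Data.List using (List; []; _∷_; _++_; _∷ʳ_; concatMap; allFin)
open import Data.List.Relation.Unary.All using (All)
open import Data.List.Relation.Unary.Any using (Any)
open import Data.Product using (Σ; _×_)
open import Relation.Binary.PropositionalEquality using (_≡_)
open import Relation.Nullary.Decidable using (⌊_⌋)
open import Function.Bundles using (_⇔_)

data Player : Set where
  Left Right : Player

_==ᴾ_ : Player → Player → Bool
Left  ==ᴾ Left  = true
Right ==ᴾ Right = true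
_     ==ᴾ _     = false

-- Short games as literal forms: a game {Y₁,…,Yₖ | Z₁,…,Zₜ} is given by
-- its (finite) list of Left options and its list of Right options.
-- 0 ≅ game [] [].

data Game : Set where
  game : List Game → List Game → Game

data _≅_ : Game → Game → Set where
  ≅-intro : ∀ {L R L′ R′} →
    All (λ Y → Any (Y ≅_) L′) L →
    All (λ Y′ → Any (_≅ Y′) L) L′ →
    All (λ Z → Any (Z ≅_) R′) R →
    All (λ Z′ → Any (_≅ Z′) R) R′ →
    game L R ≅ game L′ R′

-- A finite digraph on vertex set Fin n with a blue/red colouring
-- (blue = Left's vertices, red = Right's vertices).  Loops allowed
-- (irrelevant: the closed out-neighbourhood contains v anyway).
record Digraph : Set where
  field
    n      : ℕ
    arc    : Fin n → Fin n → Bool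
    colour : Fin n → Player

module _ (D : Digraph) where
  open Digraph D

  deleteN⁺ : (Fin n → Bool) → Fin n → (Fin n → Bool)
  deleteN⁺ R v w = R w ∧ not (⌊ v ≟ w ⌋ ∨ arc v w)

  -- game tree of the digraph placement position with remaining
  -- vertex set R; the fuel bounds the depth (each move deletes at
  -- least one vertex, so fuel n suffices from the full vertex set).
  digraphPos : ℕ → (Fin n → Bool) → Game
  digraphPos zero    R = game [] []
  digraphPos (suc k) R = game (opts Left) (opts Right)
    where
    opts : Player → List Game
    opts p = concatMap
      (λ v → if R v ∧ (colour v ==ᴾ p)
               then digraphPos k (deleteN⁺ R v) ∷ []
               else [])
      (allFin n)

digraphGame : Digraph → Game
digraphGame D = digraphPos D (Digraph.n D) (λ _ → true)

-- The moves M(X) are triples (x,T,p), modelled as the finite set Fin n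
-- together with the player p = owner m who may make it.  A position is
-- the empty board plus the sequence of moves played so far (pieces are
-- never moved or removed).  Legal h m says that move m is legal in the
-- position after playing the sequence h (in order).

record PlacementGame : Set₁ where
  field
    n         : ℕ
    owner     : Fin n → Player
    Legal     : List (Fin n) → Fin n → Set
    monotone  : ∀ h h′ m → Legal (h ++ h′) m → Legal h m

module _ (P : PlacementGame) where
  open PlacementGame P

  -- followers of the starting position: sequences of legal moves
  -- (by either player, in any order) from the empty board
  data Reachable : List (Fin n) → Set where
    start : Reachable []
    step  : ∀ {h m} → Reachable h → Legal h m → Reachable (h ∷ʳ m)

  IsConflict : Set
  IsConflict = Σ (Fin n → Subset n) λ A →
    ∀ h → Reachable h → ∀ m → (Legal h m ⇔ All (λ x → x ∉ A m) h)

  -- PlacementRep h X : the game tree of the placement game at the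
  -- position after h has literal form X (options compared as in _≅_).
  data PlacementRep (h : List (Fin n)) : Game → Set where
    rep : ∀ {L R} →
      (∀ m → owner m ≡ Left → Legal h m → Any (PlacementRep (h ∷ʳ m)) L) →
      All (λ Y → Σ (Fin n) λ m → owner m ≡ Left × Legal h m × PlacementRep (h ∷ʳ m) Y) L →
      (∀ m → owner m ≡ Right → Legal h m → Any (PlacementRep (h ∷ʳ m)) R) →
      All (λ Z → Σ (Fin n) λ m → owner m ≡ Right × Legal h m × PlacementRep (h ∷ʳ m) Z) R →
      PlacementRep h (game L R)

IsConflictPlacementGame : Game → Set₁
IsConflictPlacementGame X =
  Σ PlacementGame λ P → IsConflict P × PlacementRep P [] X

-- In a conflict placement game every move conflicts with itself: otherwise it
-- would stay legal after being played and could be replayed forever, which the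
-- finite game tree forbids.  Hence playing v forbids exactly the moves m with
-- v ∈ A m, which is what deleting N⁺[v] does in the digraph with an arc v → m
-- whenever v ∈ A m.  Conversely, a digraph placement game is the conflict
-- placement game whose conflict sets are the closed in-neighbourhoods N⁻[m].
-- In both cases the set of remaining vertices is exactly the set of moves
-- still legal, so the two game trees agree position by position.

module Submission where

open import Defs
open import Data.Bool using (Bool; true; false; T; _∧_; _∨_; not; if_then_else_)
open import Data.Bool.Properties using (T-≡; T-∧; T-∨)
open import Data.Empty using (⊥-elim)
open import Data.Fin using (Fin; _≟_)
open import Data.Fin.Subset using (Subset; _∈_; _∉_; _⊂_; ∣_∣)
open import Data.Fin.Subset.Properties using (_∈?_; ∣p∣≤n; p⊂q⇒∣p∣<∣q∣; x∈p⇒∣p-x∣<∣p∣)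
open import Data.List using (List; []; _∷_; _∷ʳ_; concatMap; allFin)
open import Data.List.Relation.Unary.All using (All; []; _∷_)
open import Data.List.Relation.Unary.All.Properties using (++⁻ˡ; ∷ʳ⁺; ∷ʳ⁻; concat⁺; map⁺)
  renaming (tabulate⁺ to All-tabulate⁺)
open import Data.List.Relation.Unary.Any using (Any; here; there)
open import Data.List.Relation.Unary.Any.Properties using (concatMap⁺)
  renaming (tabulate⁺ to Any-tabulate⁺)
open import Data.Nat using (zero; suc; _≤_)
open import Data.Nat.Properties using (≤-trans; <-≤-trans; ≤-pred; n≮0)
open import Data.Product using (Σ; _×_; _,_; proj₁; proj₂)
open import Data.Sum using ([_,_]; inj₁; inj₂)
open import Data.Unit using (tt)
open import Data.Vec using (tabulate)
open import Data.Vec.Properties using (lookup∘tabulate; []=⇒lookup; lookup⇒[]=)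
open import Function using (_∘_)
open import Function.Bundles using (_⇔_; mk⇔; Equivalence)
import Function.Properties.Equivalence as ⇔
open import Relation.Binary.PropositionalEquality using (_≡_; refl; sym; trans; subst)
open import Relation.Nullary using (¬_)
open import Relation.Nullary.Decidable using (⌊_⌋; toWitness; fromWitness; decidable-stable)

open Equivalence using (to; from)

T-not : ∀ {b} → T (not b) ⇔ (¬ T b)
T-not {true}  = mk⇔ (λ ()) (λ ¬t → ¬t tt)
T-not {false} = mk⇔ (λ _ ()) (λ _ → tt)

T-==ᴾ : ∀ {p q} → T (p ==ᴾ q) ⇔ (p ≡ q)
T-==ᴾ {Left}  {Left}  = mk⇔ (λ _ → refl) (λ _ → tt)
T-==ᴾ {Left}  {Right} = mk⇔ (λ ()) (λ ())
T-==ᴾ {Right} {Left}  = mk⇔ (λ ()) (λ ())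
T-==ᴾ {Right} {Right} = mk⇔ (λ _ → refl) (λ _ → tt)

∈-tabulate⇔T : ∀ {n} {f : Fin n → Bool} {x} → x ∈ tabulate f ⇔ T (f x)
∈-tabulate⇔T {f = f} {x} = mk⇔
  (λ x∈ → from T-≡ (trans (sym (lookup∘tabulate f x)) ([]=⇒lookup x∈)))
  (λ t → lookup⇒[]= x (tabulate f) (trans (lookup∘tabulate f x) (to T-≡ t)))

Any-if : ∀ {A : Set} {P : A → Set} {b xs} → T b → Any P xs → Any P (if b then xs else [])
Any-if {b = true} _ a = a

All-if : ∀ {A : Set} {P : A → Set} {b xs} → (T b → All P xs) → All P (if b then xs else [])
All-if {b = true}  a = a tt
All-if {b = false} _ = []

Any-concatMap-allFin : ∀ {n} {B : Set} {P : B → Set} (f : Fin n → List B) v →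
                       Any P (f v) → Any P (concatMap f (allFin n))
Any-concatMap-allFin f v = concatMap⁺ f ∘ Any-tabulate⁺ v

All-concatMap-allFin : ∀ {n} {B : Set} {P : B → Set} (f : Fin n → List B) →
                       (∀ v → All P (f v)) → All P (concatMap f (allFin n))
All-concatMap-allFin f = concat⁺ ∘ map⁺ ∘ All-tabulate⁺

-- w ∈ N⁺[v]; deleteN⁺ D R v w unfolds to R w ∧ not (closedOut arc v w).
closedOut : ∀ {n} → (Fin n → Fin n → Bool) → Fin n → Fin n → Bool
closedOut arc v w = ⌊ v ≟ w ⌋ ∨ arc v w

closedOut-refl : ∀ {n} (arc : Fin n → Fin n → Bool) v → T (closedOut arc v v)
closedOut-refl arc v = from (T-∨ {⌊ v ≟ v ⌋}) (inj₁ (fromWitness {a? = v ≟ v} refl))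

module _ (D : Digraph) where
  open Digraph D

  deleteN⁺-⊂ : ∀ {R v} → T (R v) → tabulate (deleteN⁺ D R v) ⊂ tabulate R
  deleteN⁺-⊂ {R} {v} Rv =
      (λ x∈ → from ∈-tabulate⇔T (proj₁ (to T-∧ (to ∈-tabulate⇔T x∈))))
    , v , from ∈-tabulate⇔T Rv
    , λ v∈ → to T-not (proj₂ (to T-∧ (to ∈-tabulate⇔T v∈))) (closedOut-refl arc v)

module _ (P : PlacementGame) where
  open PlacementGame P

  Option : List (Fin n) → Player → Game → Set
  Option h p Y = Σ (Fin n) λ m → owner m ≡ p × Legal h m × PlacementRep P (h ∷ʳ m) Y

  Complete : List (Fin n) → Player → List Game → Set
  Complete h p L = ∀ m → owner m ≡ p → Legal h m → Any (PlacementRep P (h ∷ʳ m)) L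

  mutual
    PlacementRep-unique : ∀ {h X Y} → PlacementRep P h X → PlacementRep P h Y → X ≅ Y
    PlacementRep-unique (rep cL oL cR oR) (rep cL′ oL′ cR′ oR′) =
      ≅-intro (options-matchˡ oL cL′) (options-matchʳ oL′ cL) (options-matchˡ oR cR′) (options-matchʳ oR′ cR)

    options-matchˡ : ∀ {h p L L′} → All (Option h p) L → Complete h p L′ → All (λ Y → Any (Y ≅_) L′) L
    options-matchˡ []                     c = []
    options-matchˡ ((m , o , l , r) ∷ os) c = option-matchˡ r (c m o l) ∷ options-matchˡ os c

    option-matchˡ : ∀ {h Y L′} → PlacementRep P h Y → Any (PlacementRep P h) L′ → Any (Y ≅_) L′
    option-matchˡ r (here r′) = here (PlacementRep-unique r r′)
    option-matchˡ r (there a) = there (option-matchˡ r a)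

    options-matchʳ : ∀ {h p L L′} → All (Option h p) L′ → Complete h p L → All (λ Y′ → Any (_≅ Y′) L) L′
    options-matchʳ []                     c = []
    options-matchʳ ((m , o , l , r) ∷ os) c = option-matchʳ r (c m o l) ∷ options-matchʳ os c

    option-matchʳ : ∀ {h Y′ L} → PlacementRep P h Y′ → Any (PlacementRep P h) L → Any (_≅ Y′) L
    option-matchʳ r′ (here r) = here (PlacementRep-unique r r′)
    option-matchʳ r′ (there a) = there (option-matchʳ r′ a)

  mutual
    PlacementRep-resp-≅ : ∀ {h X Y} → PlacementRep P h X → X ≅ Y → PlacementRep P h Y
    PlacementRep-resp-≅ (rep cL oL cR oR) (≅-intro L⊆L′ L′⊆L R⊆R′ R′⊆R) =
      rep (λ m o l → complete-resp (cL m o l) L⊆L′) (options-resp L′⊆L oL)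
          (λ m o l → complete-resp (cR m o l) R⊆R′) (options-resp R′⊆R oR)

    complete-resp : ∀ {h L L′} → Any (PlacementRep P h) L → All (λ Z → Any (Z ≅_) L′) L →
                    Any (PlacementRep P h) L′
    complete-resp (here r)  (e ∷ _)  = rep-resp-any r e
    complete-resp (there a) (_ ∷ es) = complete-resp a es

    rep-resp-any : ∀ {h X L′} → PlacementRep P h X → Any (X ≅_) L′ → Any (PlacementRep P h) L′
    rep-resp-any r (here e)  = here (PlacementRep-resp-≅ r e)
    rep-resp-any r (there a) = there (rep-resp-any r a)

    options-resp : ∀ {h p L L′} → All (λ Y′ → Any (_≅ Y′) L) L′ → All (Option h p) L → All (Option h p) L′
    options-resp []       os = []
    options-resp (e ∷ es) os = option-resp e os ∷ options-resp es os

    option-resp : ∀ {h p L Y′} → Any (_≅ Y′) L → All (Option h p) L → Option h p Y′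
    option-resp (here e)  ((m , o , l , r) ∷ _) = m , o , l , PlacementRep-resp-≅ r e
    option-resp (there a) (_ ∷ os)              = option-resp a os

  module _ (I : List (Fin n) → Set) (m : Fin n) (replay : ∀ {h} → I h → Legal h m × I (h ∷ʳ m)) where
    mutual
      replayable-no-rep : ∀ {h X} → I h → ¬ PlacementRep P h X
      replayable-no-rep i (rep cL _ cR _) with owner m in o
      ... | Left  = replayable-no-option (proj₂ (replay i)) (cL m o (proj₁ (replay i)))
      ... | Right = replayable-no-option (proj₂ (replay i)) (cR m o (proj₁ (replay i)))

      replayable-no-option : ∀ {h L} → I h → ¬ Any (PlacementRep P h) L
      replayable-no-option i (here r)  = replayable-no-rep i r
      replayable-no-option i (there a) = replayable-no-option i a

  ConflictSets : (Fin n → Subset n) → Set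
  ConflictSets A = ∀ h → Reachable P h → ∀ m → (Legal h m ⇔ All (_∉ A m) h)

  conflict-refl : ∀ {A X} → ConflictSets A → PlacementRep P [] X → ∀ m → m ∈ A m
  conflict-refl {A} conflict r m = decidable-stable (m ∈? A m) λ m∉ →
    replayable-no-rep (λ h → Reachable P h × All (_∉ A m) h) m (replay m∉) (start , []) r
    where
    replay : m ∉ A m → ∀ {h} → Reachable P h × All (_∉ A m) h →
             Legal h m × Reachable P (h ∷ʳ m) × All (_∉ A m) (h ∷ʳ m)
    replay m∉ {h} (reachable , a) = legal , step reachable legal , ∷ʳ⁺ a m∉
      where legal = from (conflict h reachable m) a

  module Realisation
    (A : Fin n → Subset n) (conflict : ConflictSets A)
    (arc : Fin n → Fin n → Bool) (closedOut⇔conflict : ∀ v w → T (closedOut arc v w) ⇔ (v ∈ A w))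
    where

    digraph : Digraph
    digraph = record { n = n ; arc = arc ; colour = owner }

    Tracks : List (Fin n) → (Fin n → Bool) → Set
    Tracks h R = ∀ w → T (R w) ⇔ All (_∉ A w) h

    tracks-∷ʳ : ∀ {h R} v → Tracks h R → Tracks (h ∷ʳ v) (deleteN⁺ digraph R v)
    tracks-∷ʳ v tracks w = mk⇔
      (λ t → let (Rw , v↛w) = to T-∧ t in
             ∷ʳ⁺ (to (tracks w) Rw) (to T-not v↛w ∘ from (closedOut⇔conflict v w)))
      (λ a → let (a′ , v∉) = ∷ʳ⁻ a in
             from T-∧ (from (tracks w) a′ , from T-not (v∉ ∘ to (closedOut⇔conflict v w))))

    represents : ∀ k {h R} → Reachable P h → Tracks h R → ∣ tabulate R ∣ ≤ k →
                 PlacementRep P h (digraphPos digraph k R)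
    represents zero {h} {R} reachable tracks bound =
      rep (λ m _ l → ⊥-elim (no-legal m l)) [] (λ m _ l → ⊥-elim (no-legal m l)) []
      where
      no-legal : ∀ m → ¬ Legal h m
      no-legal m l = n≮0 (<-≤-trans (x∈p⇒∣p-x∣<∣p∣ {p = tabulate R}
        (from ∈-tabulate⇔T (from (tracks m) (to (conflict h reachable m) l)))) bound)
    represents (suc k) {h} {R} reachable tracks bound =
      rep (complete Left) (options Left) (complete Right) (options Right)
      where
      legal⇔remaining : ∀ m → Legal h m ⇔ T (R m)
      legal⇔remaining m = mk⇔ (from (tracks m) ∘ to (conflict h reachable m))
                              (from (conflict h reachable m) ∘ to (tracks m))

      next : ∀ v → T (R v) → PlacementRep P (h ∷ʳ v) (digraphPos digraph k (deleteN⁺ digraph R v))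
      next v Rv = represents k (step reachable (from (legal⇔remaining v) Rv)) (tracks-∷ʳ v tracks)
        (≤-pred (≤-trans (p⊂q⇒∣p∣<∣q∣ (deleteN⁺-⊂ digraph Rv)) bound))

      moves : Player → Fin n → List Game
      moves p v = if R v ∧ (owner v ==ᴾ p) then digraphPos digraph k (deleteN⁺ digraph R v) ∷ [] else []

      complete : ∀ p → Complete h p (concatMap (moves p) (allFin n))
      complete p m o l = Any-concatMap-allFin (moves p) m
        (Any-if (from T-∧ (Rm , from T-==ᴾ o)) (here (next m Rm)))
        where Rm = to (legal⇔remaining m) l

      options : ∀ p → All (Option h p) (concatMap (moves p) (allFin n))
      options p = All-concatMap-allFin (moves p) λ v → All-if λ t →
        let (Rv , o) = to T-∧ t in
        (v , to T-==ᴾ o , from (legal⇔remaining v) Rv , next v Rv) ∷ []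

    digraph-represents : PlacementRep P [] (digraphGame digraph)
    digraph-represents = represents n start (λ _ → mk⇔ (λ _ → []) (λ _ → tt)) (∣p∣≤n (tabulate λ _ → true))

  module _ {A X} (conflict : ConflictSets A) (r : PlacementRep P [] X) where
    private
      inConflict : Fin n → Fin n → Bool
      inConflict v w = ⌊ v ∈? A w ⌋

      closedOut⇔inConflict : ∀ v w → T (closedOut inConflict v w) ⇔ (v ∈ A w)
      closedOut⇔inConflict v w = mk⇔
        ([ (λ v≡w → subst (_∈ A w) (sym (toWitness v≡w)) (conflict-refl conflict r w))
         , toWitness {a? = v ∈? A w} ] ∘ to (T-∨ {⌊ v ≟ w ⌋}))
        (from (T-∨ {⌊ v ≟ w ⌋}) ∘ inj₂ ∘ fromWitness {a? = v ∈? A w})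

    conflictDigraph : Digraph
    conflictDigraph = Realisation.digraph A conflict inConflict closedOut⇔inConflict

    conflictDigraph-represents : PlacementRep P [] (digraphGame conflictDigraph)
    conflictDigraph-represents = Realisation.digraph-represents A conflict inConflict closedOut⇔inConflict

module _ (D : Digraph) where
  open Digraph D

  closedIn : Fin n → Subset n
  closedIn w = tabulate λ v → closedOut arc v w

  digraphPlacement : PlacementGame
  digraphPlacement = record
    { n        = n
    ; owner    = colour
    ; Legal    = λ h m → All (_∉ closedIn m) h
    ; monotone = λ h _ _ → ++⁻ˡ h
    }

  digraphPlacement-conflict : ConflictSets digraphPlacement closedIn
  digraphPlacement-conflict _ _ _ = ⇔.refl

  digraphPlacement-represents : PlacementRep digraphPlacement [] (digraphGame D)
  digraphPlacement-represents = Realisation.digraph-represents digraphPlacement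
    closedIn digraphPlacement-conflict arc (λ _ _ → ⇔.sym ∈-tabulate⇔T)

theorem1 : (X : Game) →
    IsConflictPlacementGame X ⇔ Σ Digraph (λ G → digraphGame G ≅ X)
theorem1 X = mk⇔ conflict⇒digraph digraph⇒conflict
  where
  conflict⇒digraph : IsConflictPlacementGame X → Σ Digraph (λ G → digraphGame G ≅ X)
  conflict⇒digraph (P , (A , conflict) , r) =
    conflictDigraph P conflict r , PlacementRep-unique P (conflictDigraph-represents P conflict r) r

  digraph⇒conflict : Σ Digraph (λ G → digraphGame G ≅ X) → IsConflictPlacementGame X
  digraph⇒conflict (D , D≅X) =
    digraphPlacement D , (closedIn D , digraphPlacement-conflict D) ,
    PlacementRep-resp-≅ (digraphPlacement D) (digraphPlacement-represents D) D≅X
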